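{- Let $b,c$ be nonzero constants. Let $P_n(x)$ be defined by $P_0=1$, $P_1=x-c$, $P_n=(x-c)P_{n-1}-bxP_{n-2}$ for $n\ge2$, and let $\tilde Q_n(x)$ be defined by $\tilde Q_0=1$, $\tilde Q_1=x-(b+c)$, $\tilde Q_n=(x-(2b+c))\tilde Q_{n-1}-b(b+c)\tilde Q_{n-2}$ for $n\ge2$. Then for all $n\ge0$, $$P_n(x)=\sum_{k=0}^n\binom{n}{k}b^{n-k}\tilde Q_k(x).$$
   Context: The polynomials $\tilde Q_n$ have coefficient array equal to the Riordan array $\left(\frac{1+bt}{1+(2b+c)t+b(b+c)t^2},\frac{t}{1+(2b+c)t+b(b+c)t^2}\right)$, where the Riordan array $(g,f)$ is the lower-triangular matrix with $(n,k)$ entry $[t^n]g(t)f(t)^k$. -}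

module Defs where

open import Level using (Level)
open import Data.Nat using (ℕ; zero; suc)
open import Data.Nat.Combinatorics using (_C_)
open import Algebra.Bundles using (CommutativeRing)

module _ {c ℓ : Level} (R : CommutativeRing c ℓ) where
  open CommutativeRing R hiding (zero)

  pow : Carrier → ℕ → Carrier
  pow x zero    = 1#
  pow x (suc n) = x * pow x n

  natR : ℕ → Carrier
  natR zero    = 0#
  natR (suc n) = 1# + natR n

  sumTo : ℕ → (ℕ → Carrier) → Carrier
  sumTo zero    f = f zero
  sumTo (suc n) f = sumTo n f + f (suc n)

  P : (b c' x : Carrier) → ℕ → Carrier
  P b c' x zero          = 1#
  P b c' x (suc zero)    = x - c'
  P b c' x (suc (suc n)) = (x - c') * P b c' x (suc n) - (b * x) * P b c' x n

  Qt : (b c' x : Carrier) → ℕ → Carrier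
  Qt b c' x zero          = 1#
  Qt b c' x (suc zero)    = x - (b + c')
  Qt b c' x (suc (suc n)) =
    (x - ((b + b) + c')) * Qt b c' x (suc n) - (b * (b + c')) * Qt b c' x n

  binomQt : (b c' x : Carrier) → ℕ → Carrier
  binomQt b c' x n =
    sumTo n (λ k → (natR (n C k) * pow b (n Data.Nat.∸ k)) * Qt b c' x k)

-- For the shift operator E, the binomial transform u n = Σ_k C(n,k) b^(n-k) f k is
-- ((b + E)^n f) 0. It therefore sends solutions of f (k+2) = a f (k+1) - d f k,
-- whose characteristic roots are the roots of t² - a t + d, to solutions of the
-- recurrence with the roots shifted by b:  u (n+2) = (a + 2b) u (n+1) - (b² + a b + d) u n.
-- For Q̃ we have a = x - 2b - c and d = b (b + c), and the shifted recurrence is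
-- exactly that of P (coefficients x - c and b x); the initial values agree too.
module Submission where

open import Defs
open import Level using (Level)
open import Data.Nat using (ℕ; zero; suc; _∸_; _≤_; z≤n)
import Data.Nat as ℕ
import Data.Nat.Properties as ℕ
open import Data.Nat.Combinatorics using (_C_; nCk+nC[k+1]≡[n+1]C[k+1]; k>n⇒nCk≡0)
open import Data.Maybe using (nothing)
open import Data.Product using (_×_; _,_; proj₁)
open import Function using (_∘_)
open import Relation.Nullary using (¬_)
open import Algebra.Bundles using (CommutativeRing)
import Algebra.Properties.Group as GroupProperties
import Algebra.Properties.Quasigroup as QuasigroupProperties
import Relation.Binary.PropositionalEquality as ≡

module _ {ℓ₁ ℓ₂ : Level} (R : CommutativeRing ℓ₁ ℓ₂) where
  open CommutativeRing R hiding (zero)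
  open import Relation.Binary.Reasoning.Setoid setoid
  open import Algebra.Solver.Ring.NaturalCoefficients commutativeSemiring (λ _ _ → nothing)
  open GroupProperties +-group using (//-rightDividesˡ; quasigroup)
  open QuasigroupProperties quasigroup using (x≈z//y)

  sumTo-cong : ∀ n {f g : ℕ → Carrier} → (∀ k → k ≤ n → f k ≈ g k) →
               sumTo R n f ≈ sumTo R n g
  sumTo-cong zero    f≈g = f≈g 0 z≤n
  sumTo-cong (suc n) f≈g =
    +-cong (sumTo-cong n (λ k k≤n → f≈g k (ℕ.m≤n⇒m≤1+n k≤n))) (f≈g (suc n) ℕ.≤-refl)

  sumTo-+ : ∀ n (f g : ℕ → Carrier) →
            sumTo R n (λ k → f k + g k) ≈ sumTo R n f + sumTo R n g
  sumTo-+ zero    f g = refl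
  sumTo-+ (suc n) f g = begin
    sumTo R n (λ k → f k + g k) + (f (suc n) + g (suc n))
      ≈⟨ +-congʳ (sumTo-+ n f g) ⟩
    (sumTo R n f + sumTo R n g) + (f (suc n) + g (suc n))
      ≈⟨ solve 4 (λ F G f g → (F :+ G) :+ (f :+ g) := (F :+ f) :+ (G :+ g)) refl
           (sumTo R n f) (sumTo R n g) (f (suc n)) (g (suc n)) ⟩
    (sumTo R n f + f (suc n)) + (sumTo R n g + g (suc n)) ∎

  sumTo-*ˡ : ∀ n r (f : ℕ → Carrier) → sumTo R n (λ k → r * f k) ≈ r * sumTo R n f
  sumTo-*ˡ zero    r f = refl
  sumTo-*ˡ (suc n) r f =
    trans (+-congʳ (sumTo-*ˡ n r f)) (sym (distribˡ r (sumTo R n f) (f (suc n))))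

  sumTo-suc : ∀ n (f : ℕ → Carrier) → sumTo R (suc n) f ≈ f 0 + sumTo R n (f ∘ suc)
  sumTo-suc zero    f = refl
  sumTo-suc (suc n) f = trans (+-congʳ (sumTo-suc n f)) (+-assoc _ _ _)

  natR-+ : ∀ m n → natR R (m ℕ.+ n) ≈ natR R m + natR R n
  natR-+ zero    n = sym (+-identityˡ _)
  natR-+ (suc m) n = trans (+-congˡ (natR-+ m n)) (sym (+-assoc _ _ _))

  binomialTerm : Carrier → ℕ → (ℕ → Carrier) → ℕ → Carrier
  binomialTerm b n f k = (natR R (n C k) * pow R b (n ∸ k)) * f k

  binomial : Carrier → ℕ → (ℕ → Carrier) → Carrier
  binomial b n f = sumTo R n (binomialTerm b n f)

  binomial-zero : ∀ b (f : ℕ → Carrier) → binomial b 0 f ≈ f 0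
  binomial-zero b f = solve 1 (λ F → ((con 1 :+ con 0) :* con 1) :* F := F) refl (f 0)

  binomial-cong : ∀ b n {f g : ℕ → Carrier} → (∀ k → f k ≈ g k) →
                  binomial b n f ≈ binomial b n g
  binomial-cong b n f≈g = sumTo-cong n (λ k _ → *-congˡ (f≈g k))

  binomial-+ : ∀ b n (f g : ℕ → Carrier) →
               binomial b n (λ k → f k + g k) ≈ binomial b n f + binomial b n g
  binomial-+ b n f g = trans (sumTo-cong n (λ k _ → distribˡ _ (f k) (g k)))
                             (sumTo-+ n (binomialTerm b n f) (binomialTerm b n g))

  binomial-*ˡ : ∀ b n r (f : ℕ → Carrier) → binomial b n (λ k → r * f k) ≈ r * binomial b n f
  binomial-*ˡ b n r f = trans (sumTo-cong n (λ k _ → term k)) (sumTo-*ˡ n r (binomialTerm b n f))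
    where
    term : ∀ k → binomialTerm b n (λ k → r * f k) k ≈ r * binomialTerm b n f k
    term k = solve 3 (λ w r f → w :* (r :* f) := r :* (w :* f))
               refl (natR R (n C k) * pow R b (n ∸ k)) r (f k)

  -- Pascal's rule C(n+1,k+1) = C(n,k) + C(n,k+1) splits each term of the left-hand side.
  binomial-suc : ∀ b n (f : ℕ → Carrier) →
                 binomial b (suc n) f ≈ b * binomial b n f + binomial b n (f ∘ suc)
  binomial-suc b n f = begin
    binomial b (suc n) f                          ≈⟨ sumTo-cong (suc n) (λ k _ → pascal k) ⟩
    sumTo R (suc n) (λ k → keep k + shift k)      ≈⟨ sumTo-+ (suc n) keep shift ⟩
    sumTo R (suc n) keep + sumTo R (suc n) shift  ≈⟨ +-cong keep-sum shift-sum ⟩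
    b * binomial b n f + binomial b n (f ∘ suc)   ∎
    where
    keep : ℕ → Carrier
    keep k = (natR R (n C k) * pow R b (suc n ∸ k)) * f k
    shift : ℕ → Carrier
    shift zero    = 0#
    shift (suc k) = binomialTerm b n (f ∘ suc) k

    pascal : ∀ k → binomialTerm b (suc n) f k ≈ keep k + shift k
    pascal zero    = sym (+-identityʳ _)
    pascal (suc k) = begin
      (natR R (suc n C suc k) * w) * f (suc k)
        ≈⟨ *-congʳ (*-congʳ (reflexive (≡.cong (natR R) (≡.sym (nCk+nC[k+1]≡[n+1]C[k+1] n k))))) ⟩
      (natR R (n C k ℕ.+ n C suc k) * w) * f (suc k)
        ≈⟨ *-congʳ (*-congʳ (natR-+ (n C k) (n C suc k))) ⟩
      ((natR R (n C k) + natR R (n C suc k)) * w) * f (suc k)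
        ≈⟨ solve 4 (λ p q w F → ((p :+ q) :* w) :* F := (q :* w) :* F :+ (p :* w) :* F)
             refl (natR R (n C k)) (natR R (n C suc k)) w (f (suc k)) ⟩
      keep (suc k) + shift (suc k) ∎
      where
      w : Carrier
      w = pow R b (n ∸ k)

    keep≈b* : ∀ k → k ≤ n → keep k ≈ b * binomialTerm b n f k
    keep≈b* k k≤n = begin
      (natR R (n C k) * pow R b (suc n ∸ k)) * f k
        ≈⟨ *-congʳ (*-congˡ (reflexive (≡.cong (pow R b) (ℕ.+-∸-assoc 1 k≤n)))) ⟩
      (natR R (n C k) * (b * pow R b (n ∸ k))) * f k
        ≈⟨ solve 4 (λ p b w F → (p :* (b :* w)) :* F := b :* ((p :* w) :* F))
             refl (natR R (n C k)) b (pow R b (n ∸ k)) (f k) ⟩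
      b * binomialTerm b n f k ∎

    keep-last : keep (suc n) ≈ 0#
    keep-last = begin
      (natR R (n C suc n) * pow R b (n ∸ n)) * f (suc n)
        ≈⟨ *-congʳ (*-congʳ (reflexive (≡.cong (natR R) (k>n⇒nCk≡0 (ℕ.n<1+n n))))) ⟩
      (0# * pow R b (n ∸ n)) * f (suc n)  ≈⟨ *-congʳ (zeroˡ _) ⟩
      0# * f (suc n)                ≈⟨ zeroˡ _ ⟩
      0# ∎

    keep-sum : sumTo R (suc n) keep ≈ b * binomial b n f
    keep-sum = begin
      sumTo R n keep + keep (suc n)                   ≈⟨ +-cong (sumTo-cong n keep≈b*) keep-last ⟩
      sumTo R n (λ k → b * binomialTerm b n f k) + 0# ≈⟨ +-identityʳ _ ⟩
      sumTo R n (λ k → b * binomialTerm b n f k)      ≈⟨ sumTo-*ˡ n b _ ⟩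
      b * binomial b n f ∎

    shift-sum : sumTo R (suc n) shift ≈ binomial b n (f ∘ suc)
    shift-sum = trans (sumTo-suc n shift) (+-identityˡ _)

  -- u (n+2) = a u (n+1) - d u n, with d u n moved across so that no subtraction occurs.
  LinearRecurrence : Carrier → Carrier → (ℕ → Carrier) → Set ℓ₂
  LinearRecurrence a d u = ∀ n → u (suc (suc n)) + d * u n ≈ a * u (suc n)

  LinearRecurrence-cong : ∀ {a a′ d d′ u} → a ≈ a′ → d ≈ d′ →
                          LinearRecurrence a d u → LinearRecurrence a′ d′ u
  LinearRecurrence-cong a≈a′ d≈d′ rec n =
    trans (+-congˡ (*-congʳ (sym d≈d′))) (trans (rec n) (*-congʳ a≈a′))

  LinearRecurrence-unique : ∀ {a d u v} → LinearRecurrence a d u → LinearRecurrence a d v →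
                            u 0 ≈ v 0 → u 1 ≈ v 1 → ∀ n → u n ≈ v n
  LinearRecurrence-unique {a} {d} {u} {v} recu recv u₀≈v₀ u₁≈v₁ n = proj₁ (agree n)
    where
    agree : ∀ n → u n ≈ v n × u (suc n) ≈ v (suc n)
    agree zero    = u₀≈v₀ , u₁≈v₁
    agree (suc n) with agree n
    ... | uₙ≈vₙ , uₙ₊₁≈vₙ₊₁ = uₙ₊₁≈vₙ₊₁ , (begin
      u (suc (suc n))                                   ≈⟨ x≈z//y _ _ _ (recu n) ⟩
      a * u (suc n) - d * u n                           ≈⟨ +-cong (*-congˡ uₙ₊₁≈vₙ₊₁) (-‿cong (*-congˡ uₙ≈vₙ)) ⟩
      a * v (suc n) - d * v n                           ≈⟨ x≈z//y _ _ _ (recv n) ⟨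
      v (suc (suc n)) ∎)

  binomial-LinearRecurrence : ∀ {a d f} b → LinearRecurrence a d f →
    LinearRecurrence (a + (b + b)) (b * b + a * b + d) (λ n → binomial b n f)
  binomial-LinearRecurrence {a} {d} {f} b rec n = begin
    u (suc (suc n)) + (b * b + a * b + d) * u n
      ≈⟨ +-congʳ (binomial-suc b (suc n) f) ⟩
    (b * u (suc n) + v (suc n)) + (b * b + a * b + d) * u n
      ≈⟨ +-congʳ (+-cong (*-congˡ u-suc) (binomial-suc b n (f ∘ suc))) ⟩
    (b * (b * u n + v n) + (b * v n + w n)) + (b * b + a * b + d) * u n
      ≈⟨ solve 6 (λ a b d u v w →
             (b :* (b :* u :+ v) :+ (b :* v :+ w)) :+ (b :* b :+ a :* b :+ d) :* u
          := (w :+ d :* u) :+ ((b :+ b) :* (b :* u :+ v) :+ a :* (b :* u)))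
           refl a b d (u n) (v n) (w n) ⟩
    (w n + d * u n) + ((b + b) * (b * u n + v n) + a * (b * u n))
      ≈⟨ +-congʳ w-rec ⟩
    a * v n + ((b + b) * (b * u n + v n) + a * (b * u n))
      ≈⟨ solve 4 (λ a b u v →
             a :* v :+ ((b :+ b) :* (b :* u :+ v) :+ a :* (b :* u))
          := (a :+ (b :+ b)) :* (b :* u :+ v))
           refl a b (u n) (v n) ⟩
    (a + (b + b)) * (b * u n + v n)
      ≈⟨ *-congˡ u-suc ⟨
    (a + (b + b)) * u (suc n) ∎
    where
    u v w : ℕ → Carrier
    u m = binomial b m f
    v m = binomial b m (f ∘ suc)
    w m = binomial b m (f ∘ suc ∘ suc)

    u-suc : u (suc n) ≈ b * u n + v n
    u-suc = binomial-suc b n f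

    w-rec : w n + d * u n ≈ a * v n
    w-rec = begin
      w n + d * u n                                   ≈⟨ +-congˡ (binomial-*ˡ b n d f) ⟨
      w n + binomial b n (λ k → d * f k)              ≈⟨ binomial-+ b n (f ∘ suc ∘ suc) _ ⟨
      binomial b n (λ k → f (suc (suc k)) + d * f k)  ≈⟨ binomial-cong b n rec ⟩
      binomial b n (λ k → a * f (suc k))              ≈⟨ binomial-*ˡ b n a (f ∘ suc) ⟩
      a * v n ∎

  Qt-LinearRecurrence : ∀ b c x → LinearRecurrence (x - ((b + b) + c)) (b * (b + c)) (Qt R b c x)
  Qt-LinearRecurrence b c x n = //-rightDividesˡ _ _

  P-LinearRecurrence : ∀ b c x → LinearRecurrence (x - c) (b * x) (P R b c x)
  P-LinearRecurrence b c x n = //-rightDividesˡ _ _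

  binomQt-LinearRecurrence : ∀ b c x → LinearRecurrence (x - c) (b * x) (binomQt R b c x)
  binomQt-LinearRecurrence b c x =
    LinearRecurrence-cong a-shift d-shift (binomial-LinearRecurrence b (Qt-LinearRecurrence b c x))
    where
    m : Carrier
    m = x - ((b + b) + c)

    m+[2b+c]≈x : m + ((b + b) + c) ≈ x
    m+[2b+c]≈x = //-rightDividesˡ ((b + b) + c) x

    a-shift : m + (b + b) ≈ x - c
    a-shift = x≈z//y _ _ _ (begin
      (m + (b + b)) + c    ≈⟨ solve 3 (λ m b c → (m :+ (b :+ b)) :+ c := m :+ ((b :+ b) :+ c)) refl m b c ⟩
      m + ((b + b) + c)    ≈⟨ m+[2b+c]≈x ⟩
      x ∎)

    d-shift : b * b + m * b + b * (b + c) ≈ b * x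
    d-shift = begin
      b * b + m * b + b * (b + c)
        ≈⟨ solve 3 (λ m b c → b :* b :+ m :* b :+ b :* (b :+ c) := b :* (m :+ ((b :+ b) :+ c))) refl m b c ⟩
      b * (m + ((b + b) + c))  ≈⟨ *-congˡ m+[2b+c]≈x ⟩
      b * x ∎

  P-1≈binomQt-1 : ∀ b c x → P R b c x 1 ≈ binomQt R b c x 1
  P-1≈binomQt-1 b c x = sym (x≈z//y _ _ _ (begin
    binomQt R b c x 1 + c
      ≈⟨ solve 3 (λ b c m →
             (((con 1 :+ con 0) :* (b :* con 1)) :* con 1 :+ ((con 1 :+ con 0) :* con 1) :* m) :+ c
          := m :+ (b :+ c)) refl b c (x - (b + c)) ⟩
    (x - (b + c)) + (b + c)  ≈⟨ //-rightDividesˡ (b + c) x ⟩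
    x ∎))

mainTheorem15 : {ℓ₁ ℓ₂ : Level} (R : CommutativeRing ℓ₁ ℓ₂) →
    let open CommutativeRing R in
    (b c x : Carrier) → ¬ (b ≈ 0#) → ¬ (c ≈ 0#) →
    (n : ℕ) → P R b c x n ≈ binomQt R b c x n
mainTheorem15 R b c x _ _ =
  LinearRecurrence-unique R (P-LinearRecurrence R b c x) (binomQt-LinearRecurrence R b c x)
    (CommutativeRing.sym R (binomial-zero R b (Qt R b c x))) (P-1≈binomQt-1 R b c x)
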